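{- Let $r\geq 3$, let $y_1,\dots,y_r\in\mathbb N_0$, let $S\subseteq[r]$ be nonempty, and let $m$ be an integer with $m\geq\vert S\vert$. Let \[ \mathcal C=\{\mathbf u\in P(m,r): \mathbf u(i)=0 \text{ for some } i\in S\},\qquad \mathcal D=\{\mathbf u\in P(m,r): \mathbf u(i)=y_i \text{ for some } i\in S\}. \] If $\sum_{s\in S}y_s>0$, then $\vert\mathcal D\vert<\vert\mathcal C\vert$.
   Context: $\mathbb N_0$ is the set of non-negative integers, $[r]=\{1,\dots,r\}$, and $P(m,r)=\{(x_1,\dots,x_r)\in\mathbb N_0^r : x_1+\cdots+x_r=m\}$; for $\mathbf u=(u_1,\dots,u_r)$, $\mathbf u(i)=u_i$. -}

module Defs where

open import Data.Nat using (ℕ; zero; suc; _+_; _∸_)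
open import Data.Bool using (Bool; true; false)
open import Data.Fin using (Fin; zero; suc)
open import Data.Fin.Subset using (Subset; _∈_)
open import Data.List using (List; []; _∷_; concatMap; map; upTo; length; filter)
open import Data.Vec using (Vec; []; _∷_; lookup)
open import Data.Product using (∃; _×_)
open import Relation.Binary.PropositionalEquality using (_≡_)
open import Relation.Nullary using (Dec)
open import Relation.Nullary.Decidable using (_×-dec_)
open import Data.Fin.Properties using (any?)
open import Data.Fin.Subset.Properties using (_∈?_)
open import Data.Nat using (_≟_)

-- P(m,r): the list of all r-tuples of non-negative integers summing to m
-- (each exactly once).  A tuple of length suc r with sum m is x ∷ v with
-- x ≤ m and v ∈ P(m ∸ x, r).
P : ℕ → (r : ℕ) → List (Vec ℕ r)
P zero    zero    = [] ∷ []
P (suc m) zero    = []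
P m       (suc r) = concatMap (λ x → map (x ∷_) (P (m ∸ x) r)) (upTo (suc m))

InC : {r : ℕ} → Subset r → Vec ℕ r → Set
InC {r} S u = ∃ λ (i : Fin r) → i ∈ S × lookup u i ≡ 0

InD : {r : ℕ} → Subset r → (Fin r → ℕ) → Vec ℕ r → Set
InD {r} S y u = ∃ λ (i : Fin r) → i ∈ S × lookup u i ≡ y i

sumOver : {r : ℕ} → Subset r → (Fin r → ℕ) → ℕ
sumOver {zero}  []            y = 0
sumOver {suc r} (true  ∷ S) y = y zero + sumOver S (λ i → y (suc i))
sumOver {suc r} (false ∷ S) y = sumOver S (λ i → y (suc i))

inC? : {r : ℕ} → (S : Subset r) → (u : Vec ℕ r) → Dec (InC S u)
inC? S u = any? (λ i → (i ∈? S) ×-dec (lookup u i ≟ 0))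

inD? : {r : ℕ} → (S : Subset r) → (y : Fin r → ℕ) → (u : Vec ℕ r) → Dec (InD S y u)
inD? S y u = any? (λ i → (i ∈? S) ×-dec (lookup u i ≟ y i))

cardC : (m r : ℕ) → Subset r → ℕ
cardC m r S = length (filter (inC? S) (P m r))

cardD : (m r : ℕ) → Subset r → (Fin r → ℕ) → ℕ
cardD m r S y = length (filter (inD? S y) (P m r))

-- Pass to complements: |𝒟| < |𝒞| says that more tuples of P(m,r) avoid the values yᵢ on S than are
-- positive on S.  Both numbers obey the same recursion over the first coordinate x, except that the
-- positive count drops the term x = 0 where the avoiding count drops x = y₁.  Since the number of
-- tuples positive on S is monotone in m, dropping x = 0 removes the largest term, which gives the
-- weak inequality by induction from r = 2, where it is checked by direct counting.  Strictness
-- comes either from 1 ∈ S with y₁ > 0, using that the positive count is strictly increasing once m ≥ |S| and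
-- r ≥ 2, or else inductively from a strict instance on the last r − 1 coordinates; for r − 1 = 2
-- such an instance is found by inspection, which is why the theorem needs r ≥ 3.
module Submission where

open import Data.Bool using (Bool; true; false; not; _∧_; T; if_then_else_)
open import Data.Bool.Properties using (∧-zeroʳ)
open import Data.Fin using (Fin; zero; suc)
open import Data.Fin.Subset using (Subset; Nonempty; ∣_∣)
open import Data.List using (List; []; _∷_; _++_; map; concatMap; applyUpTo; upTo; length; filter)
open import Data.Nat using (ℕ; zero; suc; _+_; _∸_; _≤_; _<_; _≡ᵇ_; z≤n; s≤s; s≤s⁻¹; z<s; _<?_; _≤′_; ≤′-refl; ≤′-step)
open import Data.Nat.Properties
open import Data.Product using (∃-syntax; _×_; _,_)
open import Data.Vec using (Vec; []; _∷_; here; there)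
open import Data.Vec.Functional using (tail)
open import Function using (_∘_)
open import Relation.Binary.PropositionalEquality
open import Relation.Nullary using (yes; no; contradiction)
open import Relation.Unary using (Pred; Decidable)

open import Defs

keepIf : Bool → ℕ → ℕ
keepIf true  n = n
keepIf false n = 0

keepIf-zero : ∀ b → keepIf b 0 ≡ 0
keepIf-zero true  = refl
keepIf-zero false = refl

keepIf-≤ : ∀ b n → keepIf b n ≤ n
keepIf-≤ true  n = ≤-refl
keepIf-≤ false n = z≤n

keepIf-mono : ∀ b {m n} → m ≤ n → keepIf b m ≤ keepIf b n
keepIf-mono true  m≤n = m≤n
keepIf-mono false m≤n = z≤n

sumBelow : ℕ → (ℕ → ℕ) → ℕ
sumBelow zero    f = 0
sumBelow (suc n) f = f 0 + sumBelow n (f ∘ suc)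

infix 2 sumBelow
syntax sumBelow n (λ x → e) = ∑[ x < n ] e

sum-cong : ∀ n {f g : ℕ → ℕ} → (∀ x → f x ≡ g x) → sumBelow n f ≡ sumBelow n g
sum-cong zero    f≗g = refl
sum-cong (suc n) f≗g = cong₂ _+_ (f≗g 0) (sum-cong n (f≗g ∘ suc))

sum-mono : ∀ n {f g : ℕ → ℕ} → (∀ x → f x ≤ g x) → sumBelow n f ≤ sumBelow n g
sum-mono zero    f≤g = z≤n
sum-mono (suc n) f≤g = +-mono-≤ (f≤g 0) (sum-mono n (f≤g ∘ suc))

sum-mono-< : ∀ n {f g : ℕ → ℕ} {x} → (∀ x → f x ≤ g x) → x < n → f x < g x →
             sumBelow n f < sumBelow n g
sum-mono-< (suc n) {x = zero}  f≤g _         fx<gx = +-mono-<-≤ fx<gx (sum-mono n (f≤g ∘ suc))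
sum-mono-< (suc n) {x = suc x} f≤g (s≤s x<n) fx<gx = +-mono-≤-< (f≤g 0) (sum-mono-< n (f≤g ∘ suc) x<n fx<gx)

sum-reverse : ∀ (f : ℕ → ℕ) m → (∑[ x < suc m ] f (m ∸ x)) ≡ sumBelow (suc m) f
sum-reverse f zero    = refl
sum-reverse f (suc m) = begin
  f (suc m) + sumBelow (suc m) (λ x → f (m ∸ x)) ≡⟨ cong (f (suc m) +_) (sum-reverse f m) ⟩
  f (suc m) + sumBelow (suc m) f                 ≡⟨ +-comm (f (suc m)) _ ⟩
  sumBelow (suc m) f + f (suc m)                 ≡⟨ sym (sum-snoc f (suc m)) ⟩
  sumBelow (suc (suc m)) f                       ∎
  where
  open ≡-Reasoning
  sum-snoc : ∀ (f : ℕ → ℕ) n → sumBelow (suc n) f ≡ sumBelow n f + f n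
  sum-snoc f zero    = +-identityʳ (f 0)
  sum-snoc f (suc n) = trans (cong (f 0 +_) (sum-snoc (f ∘ suc) n)) (sym (+-assoc (f 0) _ _))

sum-δ : ∀ (F : ℕ → ℕ → ℕ) j → (∀ x → F x 0 ≡ 0) →
        (∑[ x < suc j ] F x (keepIf (j ∸ x ≡ᵇ 0) 1)) ≡ F j 1
sum-δ F zero    F0≡0 = +-identityʳ (F 0 1)
sum-δ F (suc j) F0≡0 rewrite F0≡0 0 = sum-δ (F ∘ suc) j (F0≡0 ∘ suc)

sumExcept : ℕ → ℕ → (ℕ → ℕ) → ℕ
sumExcept c n f = ∑[ x < n ] keepIf (not (x ≡ᵇ c)) (f x)

sumExcept-+ : ∀ (f : ℕ → ℕ) n c → c < n → sumExcept c n f + f c ≡ sumBelow n f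
sumExcept-+ f (suc n) zero    _         = +-comm (sumBelow n (f ∘ suc)) (f 0)
sumExcept-+ f (suc n) (suc c) (s≤s c<n) =
  trans (+-assoc (f 0) _ _) (cong (f 0 +_) (sumExcept-+ (f ∘ suc) n c c<n))

sumExcept-≥ : ∀ (f : ℕ → ℕ) n c → n ≤ c → sumExcept c n f ≡ sumBelow n f
sumExcept-≥ f zero    c       _         = refl
sumExcept-≥ f (suc n) (suc c) (s≤s n≤c) = cong (f 0 +_) (sumExcept-≥ (f ∘ suc) n c n≤c)

sum≤sumExcept+ : ∀ (f : ℕ → ℕ) n c {a} → (c < n → f c ≤ a) → sumBelow n f ≤ sumExcept c n f + a
sum≤sumExcept+ f n c {a} fc≤a with c <? n
... | yes c<n = ≤-trans (≤-reflexive (sym (sumExcept-+ f n c c<n))) (+-monoʳ-≤ _ (fc≤a c<n))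
... | no  c≮n = ≤-trans (≤-reflexive (sym (sumExcept-≥ f n c (≮⇒≥ c≮n)))) (m≤m+n _ a)

sum<sumExcept+ : ∀ (f : ℕ → ℕ) n c {a} → 0 < a → (c < n → f c < a) → sumBelow n f < sumExcept c n f + a
sum<sumExcept+ f n c {a} a>0 fc<a with c <? n
... | yes c<n = ≤-<-trans (≤-reflexive (sym (sumExcept-+ f n c c<n))) (+-monoʳ-< _ (fc<a c<n))
... | no  c≮n = ≤-<-trans (≤-reflexive (sym (sumExcept-≥ f n c (≮⇒≥ c≮n)))) (m<m+n _ a>0)

sumExcept-mono : ∀ c n {f g : ℕ → ℕ} → (∀ x → f x ≤ g x) → sumExcept c n f ≤ sumExcept c n g
sumExcept-mono c n f≤g = sum-mono n (λ x → keepIf-mono (not (x ≡ᵇ c)) (f≤g x))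

sumExcept-swap : ∀ (f : ℕ → ℕ) n {c d} → d < n → (c < n → f c ≤ f d) → sumExcept d n f ≤ sumExcept c n f
sumExcept-swap f n {c} {d} d<n fc≤fd = +-cancelʳ-≤ (f d) _ _
  (≤-trans (≤-reflexive (sumExcept-+ f n d d<n)) (sum≤sumExcept+ f n c fc≤fd))

sumExcept-swap-< : ∀ (f : ℕ → ℕ) n {c d} → d < n → 0 < f d → (c < n → f c < f d) →
                   sumExcept d n f < sumExcept c n f
sumExcept-swap-< f n {c} {d} d<n fd>0 fc<fd = +-cancelʳ-< (f d) _ _
  (≤-<-trans (≤-reflexive (sumExcept-+ f n d d<n)) (sum<sumExcept+ f n c fd>0 fc<fd))

-- |P(m,r) ∖ 𝒟|, by recursion on the first coordinate; positiveCount m S is |P(m,r) ∖ 𝒞|.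
avoidCount : ∀ {r} → ℕ → Subset r → (Fin r → ℕ) → ℕ
avoidCount m []      y = keepIf (m ≡ᵇ 0) 1
avoidCount m (b ∷ S) y =
  ∑[ x < suc m ] keepIf (not (b ∧ (x ≡ᵇ y zero))) (avoidCount (m ∸ x) S (tail y))

positiveCount : ∀ {r} → ℕ → Subset r → ℕ
positiveCount m S = avoidCount m S (λ _ → 0)

avoids : ∀ {r} → Subset r → (Fin r → ℕ) → Vec ℕ r → Bool
avoids []      y []      = true
avoids (b ∷ S) y (x ∷ u) = not (b ∧ (x ≡ᵇ y zero)) ∧ avoids S (tail y) u

InD⇒avoids≡false : ∀ {r} (S : Subset r) y u → InD S y u → avoids S y u ≡ false
InD⇒avoids≡false (true ∷ S) y (x ∷ u) (zero , here , x≡y₀) with x ≡ᵇ y zero in eq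
... | true  = refl
... | false = contradiction (subst T eq (≡⇒≡ᵇ x (y zero) x≡y₀)) λ ()
InD⇒avoids≡false (b ∷ S) y (x ∷ u) (suc i , there i∈S , uᵢ≡yᵢ) =
  trans (cong (_ ∧_) (InD⇒avoids≡false S (tail y) u (i , i∈S , uᵢ≡yᵢ))) (∧-zeroʳ _)

avoids≡false⇒InD : ∀ {r} (S : Subset r) y u → avoids S y u ≡ false → InD S y u
avoids≡false⇒InD [] y [] ()
avoids≡false⇒InD (false ∷ S) y (x ∷ u) eq with i , i∈S , uᵢ≡yᵢ ← avoids≡false⇒InD S (tail y) u eq =
  suc i , there i∈S , uᵢ≡yᵢ
avoids≡false⇒InD (true ∷ S) y (x ∷ u) eq with x ≡ᵇ y zero in x≡ᵇy₀
... | true  = zero , here , ≡ᵇ⇒≡ x (y zero) (subst T (sym x≡ᵇy₀) _)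
... | false with i , i∈S , uᵢ≡yᵢ ← avoids≡false⇒InD S (tail y) u eq = suc i , there i∈S , uᵢ≡yᵢ

count : ∀ {A : Set} → (A → Bool) → List A → ℕ
count p []       = 0
count p (a ∷ as) = keepIf (p a) 1 + count p as

count-++ : ∀ {A : Set} (p : A → Bool) xs ys → count p (xs ++ ys) ≡ count p xs + count p ys
count-++ p []       ys = refl
count-++ p (x ∷ xs) ys = trans (cong (keepIf (p x) 1 +_) (count-++ p xs ys)) (sym (+-assoc (keepIf (p x) 1) _ _))

count-concatMap : ∀ {A : Set} (p : A → Bool) (g : ℕ → List A) h n →
                  count p (concatMap g (applyUpTo h n)) ≡ (∑[ x < n ] count p (g (h x)))
count-concatMap p g h zero    = refl
count-concatMap p g h (suc n) =
  trans (count-++ p (g (h 0)) _) (cong (count p (g (h 0)) +_) (count-concatMap p g (h ∘ suc) n))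

count-map : ∀ {A B : Set} (p : B → Bool) (f : A → B) xs → count p (map f xs) ≡ count (p ∘ f) xs
count-map p f []       = refl
count-map p f (x ∷ xs) = cong (keepIf (p (f x)) 1 +_) (count-map p f xs)

count-∧ : ∀ {A : Set} t (p : A → Bool) xs → count (λ a → t ∧ p a) xs ≡ keepIf t (count p xs)
count-∧ true  p xs       = refl
count-∧ false p []       = refl
count-∧ false p (x ∷ xs) = count-∧ false p xs

length-filter+count : ∀ {A : Set} {ℓ} {P : Pred A ℓ} (P? : Decidable P) (p : A → Bool) →
  (∀ {a} → P a → p a ≡ false) → (∀ {a} → p a ≡ false → P a) →
  ∀ xs → length (filter P? xs) + count p xs ≡ length xs
length-filter+count P? p P⇒ ⇒P []       = refl
length-filter+count P? p P⇒ ⇒P (x ∷ xs) with P? x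
... | yes Px rewrite P⇒ Px = cong suc (length-filter+count P? p P⇒ ⇒P xs)
... | no ¬Px with p x in px
...   | false = contradiction (⇒P px) ¬Px
...   | true  = trans (+-suc _ _) (cong suc (length-filter+count P? p P⇒ ⇒P xs))

-- The list is the last defining clause of P m (suc r), which only unfolds once m is a constructor.
count-avoids-cons : ∀ {r} b (S : Subset r) y m →
  (∀ k → count (avoids S (tail y)) (P k r) ≡ avoidCount k S (tail y)) →
  count (avoids (b ∷ S) y) (concatMap (λ x → map (x ∷_) (P (m ∸ x) r)) (upTo (suc m))) ≡ avoidCount m (b ∷ S) y
count-avoids-cons {r} b S y m ih = begin
  count (avoids (b ∷ S) y) (concatMap (λ x → map (x ∷_) (P (m ∸ x) r)) (upTo (suc m)))
    ≡⟨ count-concatMap (avoids (b ∷ S) y) (λ x → map (x ∷_) (P (m ∸ x) r)) (λ x → x) (suc m) ⟩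
  (∑[ x < suc m ] count (avoids (b ∷ S) y) (map (x ∷_) (P (m ∸ x) r)))
    ≡⟨ sum-cong (suc m) (λ x → trans (count-map (avoids (b ∷ S) y) (x ∷_) (P (m ∸ x) r))
                                      (count-∧ (not (b ∧ (x ≡ᵇ y zero))) (avoids S (tail y)) (P (m ∸ x) r))) ⟩
  (∑[ x < suc m ] keepIf (not (b ∧ (x ≡ᵇ y zero))) (count (avoids S (tail y)) (P (m ∸ x) r)))
    ≡⟨ sum-cong (suc m) (λ x → cong (keepIf (not (b ∧ (x ≡ᵇ y zero)))) (ih (m ∸ x))) ⟩
  avoidCount m (b ∷ S) y ∎
  where open ≡-Reasoning

count-avoids-P : ∀ m r (S : Subset r) y → count (avoids S y) (P m r) ≡ avoidCount m S y
count-avoids-P zero    zero    []      y = refl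
count-avoids-P (suc m) zero    []      y = refl
count-avoids-P zero    (suc r) (b ∷ S) y = count-avoids-cons b S y zero    (λ k → count-avoids-P k r S (tail y))
count-avoids-P (suc m) (suc r) (b ∷ S) y = count-avoids-cons b S y (suc m) (λ k → count-avoids-P k r S (tail y))

cardD+avoidCount : ∀ m r (S : Subset r) y → cardD m r S y + avoidCount m S y ≡ length (P m r)
cardD+avoidCount m r S y = begin
  cardD m r S y + avoidCount m S y                  ≡⟨ cong (cardD m r S y +_) (count-avoids-P m r S y) ⟨
  cardD m r S y + count (avoids S y) (P m r)        ≡⟨ length-filter+count (inD? S y) (avoids S y)
                                                         (InD⇒avoids≡false S y _) (avoids≡false⇒InD S y _) (P m r) ⟩
  length (P m r)                                    ∎
  where open ≡-Reasoning

positiveCount-suc : ∀ {r} b (S : Subset r) m →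
  positiveCount (suc m) (b ∷ S) ≡ positiveCount m (b ∷ S) + positiveCount (if b then m else suc m) S
positiveCount-suc true  S m = sym (sumExcept-+ (λ x → positiveCount (m ∸ x) S) (suc m) 0 z<s)
positiveCount-suc false S m = +-comm (positiveCount (suc m) S) _

positiveCount-pos-∣∣ : ∀ {r} (S : Subset r) → 0 < positiveCount ∣ S ∣ S
positiveCount-pos-∣∣ []          = z<s
positiveCount-pos-∣∣ (true ∷ S)  rewrite positiveCount-suc true S ∣ S ∣ =
  <-≤-trans (positiveCount-pos-∣∣ S) (m≤n+m _ _)
positiveCount-pos-∣∣ (false ∷ S) = <-≤-trans (positiveCount-pos-∣∣ S) (m≤m+n _ _)

positiveCount-step : ∀ {r} (S : Subset (suc r)) m → positiveCount m S ≤ positiveCount (suc m) S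
positiveCount-step (b ∷ S) m rewrite positiveCount-suc b S m = m≤m+n _ _

positiveCount-mono : ∀ {r} (S : Subset (suc r)) {j k} → j ≤ k → positiveCount j S ≤ positiveCount k S
positiveCount-mono S j≤k = go (≤⇒≤′ j≤k)
  where
  go : ∀ {j k} → j ≤′ k → positiveCount j S ≤ positiveCount k S
  go ≤′-refl           = ≤-refl
  go (≤′-step {n} j≤n) = ≤-trans (go j≤n) (positiveCount-step S n)

positiveCount-pos : ∀ {r} (S : Subset (suc r)) {m} → ∣ S ∣ ≤ m → 0 < positiveCount m S
positiveCount-pos S ∣S∣≤m = <-≤-trans (positiveCount-pos-∣∣ S) (positiveCount-mono S ∣S∣≤m)

positiveCount-step-< : ∀ {r} (S : Subset (suc (suc r))) m → ∣ S ∣ ≤ suc m →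
                       positiveCount m S < positiveCount (suc m) S
positiveCount-step-< (true ∷ S)  m (s≤s ∣S∣≤m) rewrite positiveCount-suc true S m =
  m<m+n _ (positiveCount-pos S ∣S∣≤m)
positiveCount-step-< (false ∷ S) m ∣S∣≤1+m    rewrite positiveCount-suc false S m =
  m<m+n _ (positiveCount-pos S ∣S∣≤1+m)

positiveCount-mono-< : ∀ {r} (S : Subset (suc (suc r))) {j k} → ∣ S ∣ ≤ k → j < k →
                       positiveCount j S < positiveCount k S
positiveCount-mono-< S {k = suc m} ∣S∣≤1+m (s≤s j≤m) =
  ≤-<-trans (positiveCount-mono S j≤m) (positiveCount-step-< S m ∣S∣≤1+m)

avoidCount-single : ∀ j (y : Fin 1 → ℕ) → avoidCount j (true ∷ []) y ≡ keepIf (not (j ≡ᵇ y zero)) 1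
avoidCount-single j y = sum-δ (λ x → keepIf (not (x ≡ᵇ y zero))) j (λ _ → keepIf-zero _)

avoidCount-single≤1 : ∀ j (y : Fin 1 → ℕ) → avoidCount j (true ∷ []) y ≤ 1
avoidCount-single≤1 j y = subst (_≤ 1) (sym (avoidCount-single j y)) (keepIf-≤ _ 1)

avoidCount-false≤true+ : ∀ {r} (S : Subset r) y m {a} → (∀ j → avoidCount j S (tail y) ≤ a) →
                         avoidCount m (false ∷ S) y ≤ avoidCount m (true ∷ S) y + a
avoidCount-false≤true+ S y m ≤a = sum≤sumExcept+ (λ x → avoidCount (m ∸ x) S (tail y)) (suc m) (y zero) (λ _ → ≤a _)

positiveCount≤avoidCount-cons : ∀ {r} b (S : Subset (suc r)) y →
  (∀ j → positiveCount j S ≤ avoidCount j S (tail y)) → ∀ m → positiveCount m (b ∷ S) ≤ avoidCount m (b ∷ S) y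
positiveCount≤avoidCount-cons false S y ih m = sum-mono (suc m) (λ x → ih (m ∸ x))
positiveCount≤avoidCount-cons true  S y ih m = begin
  positiveCount m (true ∷ S)
    ≤⟨ sumExcept-swap (λ x → positiveCount (m ∸ x) S) (suc m) {c = y zero} z<s
         (λ _ → positiveCount-mono S (m∸n≤m m (y zero))) ⟩
  sumExcept (y zero) (suc m) (λ x → positiveCount (m ∸ x) S)
    ≤⟨ sumExcept-mono (y zero) (suc m) (ih ∘ (m ∸_)) ⟩
  avoidCount m (true ∷ S) y ∎
  where open ≤-Reasoning

avoidCount-ft : ∀ (y : Fin 2 → ℕ) m →
                avoidCount m (false ∷ true ∷ []) y ≡ sumExcept (y (suc zero)) (suc m) (λ _ → 1)
avoidCount-ft y m = trans (sum-cong (suc m) (λ x → avoidCount-single (m ∸ x) (tail y)))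
                          (sum-reverse (λ k → keepIf (not (k ≡ᵇ y (suc zero))) 1) m)

positiveCount≤avoidCount-ft : ∀ y m → positiveCount m (false ∷ true ∷ []) ≤ avoidCount m (false ∷ true ∷ []) y
positiveCount≤avoidCount-ft y m = begin
  positiveCount m (false ∷ true ∷ [])         ≡⟨ avoidCount-ft (λ _ → 0) m ⟩
  sumExcept 0 (suc m) (λ _ → 1)               ≤⟨ sumExcept-swap (λ _ → 1) (suc m) {c = y (suc zero)} z<s (λ _ → ≤-refl) ⟩
  sumExcept (y (suc zero)) (suc m) (λ _ → 1)  ≡⟨ avoidCount-ft y m ⟨
  avoidCount m (false ∷ true ∷ []) y          ∎
  where open ≤-Reasoning

positiveCount≤avoidCount-tt : ∀ y m → positiveCount m (true ∷ true ∷ []) ≤ avoidCount m (true ∷ true ∷ []) y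
positiveCount≤avoidCount-tt y zero    = z≤n
positiveCount≤avoidCount-tt y (suc m) = +-cancelʳ-≤ 1 _ _ (begin
  positiveCount (suc m) (true ∷ true ∷ []) + 1
    ≡⟨ cong (positiveCount (suc m) (true ∷ true ∷ []) +_) (avoidCount-single (suc m) (λ _ → 0)) ⟨
  positiveCount (suc m) (true ∷ true ∷ []) + positiveCount (suc m) (true ∷ [])
    ≡⟨ +-comm _ (positiveCount (suc m) (true ∷ [])) ⟩
  positiveCount (suc m) (false ∷ true ∷ [])
    ≤⟨ positiveCount≤avoidCount-ft y (suc m) ⟩
  avoidCount (suc m) (false ∷ true ∷ []) y
    ≤⟨ avoidCount-false≤true+ (true ∷ []) y (suc m) (λ j → avoidCount-single≤1 j (tail y)) ⟩
  avoidCount (suc m) (true ∷ true ∷ []) y + 1 ∎)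
  where open ≤-Reasoning

-- Fails for r = 1 (take m = y₁ > 0), so the induction starts at r = 2.
positiveCount≤avoidCount : ∀ {r} (S : Subset (suc (suc r))) y m → positiveCount m S ≤ avoidCount m S y
positiveCount≤avoidCount {zero}  (b ∷ false ∷ [])    y = positiveCount≤avoidCount-cons b (false ∷ []) y (λ _ → ≤-refl)
positiveCount≤avoidCount {zero}  (false ∷ true ∷ []) y = positiveCount≤avoidCount-ft y
positiveCount≤avoidCount {zero}  (true ∷ true ∷ [])  y = positiveCount≤avoidCount-tt y
positiveCount≤avoidCount {suc r} (b ∷ S)             y =
  positiveCount≤avoidCount-cons b S y (positiveCount≤avoidCount S (tail y))

positiveCount<avoidCount-cons : ∀ {r} (S : Subset (suc (suc r))) y (t : ℕ → Bool) {j m} →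
  positiveCount j S < avoidCount j S y → j ≤ m → t (m ∸ j) ≡ true →
  (∑[ x < suc m ] keepIf (t x) (positiveCount (m ∸ x) S)) < (∑[ x < suc m ] keepIf (t x) (avoidCount (m ∸ x) S y))
positiveCount<avoidCount-cons S y t {j} {m} pc<ac j≤m t≡true =
  sum-mono-< (suc m) (λ x → keepIf-mono (t x) (positiveCount≤avoidCount S y (m ∸ x))) (s≤s (m∸n≤m m j))
    (subst (λ b → keepIf b _ < keepIf b _) (sym t≡true) pc<ac′)
  where
  pc<ac′ : positiveCount (m ∸ (m ∸ j)) S < avoidCount (m ∸ (m ∸ j)) S y
  pc<ac′ rewrite m∸[m∸n]≡n j≤m = pc<ac

positiveCount<avoidCount-head : ∀ {r} (S : Subset (suc (suc r))) y {m} → 0 < y zero → suc ∣ S ∣ ≤ m →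
                                positiveCount m (true ∷ S) < avoidCount m (true ∷ S) y
positiveCount<avoidCount-head S y {m} y₀>0 ∣S∣<m = begin-strict
  positiveCount m (true ∷ S)
    <⟨ sumExcept-swap-< (λ x → positiveCount (m ∸ x) S) (suc m) {c = y zero} z<s (positiveCount-pos S ∣S∣≤m)
         (λ y₀≤m → positiveCount-mono-< S ∣S∣≤m (∸-monoʳ-< y₀>0 (s≤s⁻¹ y₀≤m))) ⟩
  sumExcept (y zero) (suc m) (λ x → positiveCount (m ∸ x) S)
    ≤⟨ sumExcept-mono (y zero) (suc m) (λ x → positiveCount≤avoidCount S (tail y) (m ∸ x)) ⟩
  avoidCount m (true ∷ S) y ∎
  where
  open ≤-Reasoning
  ∣S∣≤m : ∣ S ∣ ≤ m
  ∣S∣≤m = <⇒≤ ∣S∣<m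

n∸m≢ᵇ0 : ∀ {m n} → m < n → not (n ∸ m ≡ᵇ 0) ≡ true
n∸m≢ᵇ0 {m} {n} m<n with n ∸ m | m>n⇒m∸n≢0 m<n
... | zero  | n∸m≢0 = contradiction refl n∸m≢0
... | suc _ | _     = refl

sumOver-cong : ∀ {r} (S : Subset r) {y y′ : Fin r → ℕ} → (∀ i → y i ≡ y′ i) → sumOver S y ≡ sumOver S y′
sumOver-cong []          y≗y′ = refl
sumOver-cong (true ∷ S)  y≗y′ = cong₂ _+_ (y≗y′ zero) (sumOver-cong S (y≗y′ ∘ suc))
sumOver-cong (false ∷ S) y≗y′ = sumOver-cong S (y≗y′ ∘ suc)

avoidCount-cong : ∀ {r} m (S : Subset r) {y y′ : Fin r → ℕ} → (∀ i → y i ≡ y′ i) →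
                  avoidCount m S y ≡ avoidCount m S y′
avoidCount-cong m []      y≗y′ = refl
avoidCount-cong m (b ∷ S) y≗y′ = sum-cong (suc m) λ x →
  cong₂ (λ c n → keepIf (not (b ∧ (x ≡ᵇ c))) n) (y≗y′ zero) (avoidCount-cong (m ∸ x) S (y≗y′ ∘ suc))

StrictWitness : ∀ {r} → Subset r → (Fin r → ℕ) → Set
StrictWitness S y = ∃[ j ] j ≤ ∣ S ∣ × positiveCount j S < avoidCount j S y

strictWitness₂ : ∀ (S : Subset 2) y → 0 < sumOver S y → StrictWitness S y
strictWitness₂ S y Σy>0 =
  transport (witness S (y zero) (y (suc zero)) (subst (0 <_) (sumOver-cong S pair-η) Σy>0))
  where
  pair : ℕ → ℕ → Fin 2 → ℕ
  pair a b zero       = a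
  pair a b (suc zero) = b

  pair-η : ∀ i → y i ≡ pair (y zero) (y (suc zero)) i
  pair-η zero       = refl
  pair-η (suc zero) = refl

  witness : ∀ S a b → 0 < sumOver S (pair a b) → StrictWitness S (pair a b)
  witness (false ∷ false ∷ []) a       b       ()
  witness (false ∷ true ∷ [])  a       zero    ()
  witness (false ∷ true ∷ [])  a       (suc b) _ = 0 , z≤n , z<s
  witness (true ∷ false ∷ [])  zero    b       ()
  witness (true ∷ false ∷ [])  (suc a) b       _ = 0 , z≤n , z<s
  witness (true ∷ true ∷ [])   zero    zero    ()
  witness (true ∷ true ∷ [])   zero    (suc b) _ = 1 , s≤s z≤n , z<s
  witness (true ∷ true ∷ [])   (suc a) zero    _ = 1 , s≤s z≤n , z<s
  witness (true ∷ true ∷ [])   (suc a) (suc b) _ = 0 , z≤n , z<s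

  transport : StrictWitness S (pair (y zero) (y (suc zero))) → StrictWitness S y
  transport (j , j≤∣S∣ , pc<ac) = j , j≤∣S∣ , subst (positiveCount j S <_) (sym (avoidCount-cong j S pair-η)) pc<ac

-- For r = 2 strictness can fail for m ≥ |S| (S = [2], y = (0, 1), m = 2), hence only a witness.
strictWitness : ∀ {r} (S : Subset (suc (suc r))) y → 0 < sumOver S y → StrictWitness S y
positiveCount<avoidCount : ∀ {r} (S : Subset (suc (suc (suc r)))) y {m} → ∣ S ∣ ≤ m → 0 < sumOver S y →
                           positiveCount m S < avoidCount m S y

strictWitness {zero}  S y Σy>0 = strictWitness₂ S y Σy>0
strictWitness {suc r} S y Σy>0 = ∣ S ∣ , ≤-refl , positiveCount<avoidCount S y ≤-refl Σy>0

positiveCount<avoidCount (false ∷ S) y ∣S∣≤m Σy>0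
  with j , j≤∣S∣ , pc<ac ← strictWitness S (tail y) Σy>0
  = positiveCount<avoidCount-cons S (tail y) (λ _ → true) pc<ac (≤-trans j≤∣S∣ ∣S∣≤m) refl
positiveCount<avoidCount (true ∷ S) y {m} ∣S∣<m Σy>0 with y zero ≟ 0
... | no y₀≢0 = positiveCount<avoidCount-head S y (n≢0⇒n>0 y₀≢0) ∣S∣<m
... | yes y₀≡0
  with j , j≤∣S∣ , pc<ac ← strictWitness S (tail y) (subst (λ a → 0 < a + sumOver S (tail y)) y₀≡0 Σy>0)
  = subst (λ c → positiveCount m (true ∷ S) < sumExcept c (suc m) (λ x → avoidCount (m ∸ x) S (tail y))) (sym y₀≡0)
      (positiveCount<avoidCount-cons S (tail y) (λ x → not (x ≡ᵇ 0)) pc<ac (≤-trans j≤∣S∣ (<⇒≤ ∣S∣<m))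
        (n∸m≢ᵇ0 (<-≤-trans (s≤s j≤∣S∣) ∣S∣<m)))

theorem2p4 : (r : ℕ) → 3 ≤ r → (y : Fin r → ℕ) → (S : Subset r) → Nonempty S
    → (m : ℕ) → ∣ S ∣ ≤ m → 0 < sumOver S y → cardD m r S y < cardC m r S
-- Nonempty S is implied by 0 < sumOver S y.
theorem2p4 (suc (suc (suc r))) (s≤s (s≤s (s≤s z≤n))) y S _ m ∣S∣≤m Σy>0 =
  +-cancelʳ-< (avoidCount m S y) _ _ (begin-strict
    cardD m _ S y + avoidCount m S y  ≡⟨ cardD+avoidCount m _ S y ⟩
    length (P m _)                    ≡⟨ cardD+avoidCount m _ S (λ _ → 0) ⟨
    cardC m _ S + positiveCount m S   <⟨ +-monoʳ-< (cardC m _ S) (positiveCount<avoidCount S y ∣S∣≤m Σy>0) ⟩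
    cardC m _ S + avoidCount m S y    ∎)
  where open ≤-Reasoning
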